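{- Let $G$ be a finite graph (without loops) such that $\Delta(G)\geqslant 2$ and such that $G$ has no spanning even subgraph without isolated vertices. Then $\check s(G)>\delta(G)$.
   Context: $\Delta(G)$ and $\delta(G)$ denote the maximum and minimum degree of $G$. An edge-coloring of $G$ is a map $c\colon E(G)\to\{1,\dots,k\}$ (for some $k$) such that any two incident edges receive different colors. The palette of a vertex $v$ with respect to $c$ is $P_c(v)=\{c(e): e\in E(G) \text{ incident to } v\}$. The palette index $\check s(G)$ is the minimum, over all edge-colorings $c$ of $G$, of the number of distinct palettes $P_c(v)$, $v\in V(G)$. An even subgraph of $G$ is a subgraph in which every vertex has even degree; a spanning even subgraph is an even subgraph $K$ with $V(K)=V(G)$. "Without isolated vertices" means every vertex of $K$ has degree at least $1$ (equivalently, at least $2$) in $K$. -}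

module Defs where

open import Data.Nat using (ℕ; _⊔_; _⊓_; _<_; _≤_)
open import Data.Nat.Divisibility using (_∣_)
open import Data.Fin using (Fin)
open import Data.Fin.Properties renaming (_≟_ to _≟ᶠ_)
open import Data.Fin.Subset using (Subset; inside; outside)
open import Data.Bool using (Bool; true; false; T)
import Data.Bool.Properties as BoolP
open import Data.Vec using (tabulate)
open import Data.Vec.Properties using (≡-dec)
open import Data.List using (List; []; _∷_; length; filter; map; foldr; allFin; deduplicate)
open import Data.Bool.ListAction using (any)
open import Data.Product using (_×_; _,_; proj₁; proj₂; ∃; ∃-syntax)
open import Data.Sum using (_⊎_)
open import Relation.Nullary using (¬_; Dec; yes; no)
open import Relation.Nullary.Decidable using (⌊_⌋; _⊎-dec_; _×-dec_)
open import Relation.Binary.PropositionalEquality using (_≡_; _≢_)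

record Graph : Set where
  field
    n      : ℕ
    m      : ℕ
    ends   : Fin m → Fin n × Fin n
    loopless : ∀ e → proj₁ (ends e) ≢ proj₂ (ends e)

open Graph public

Incident : (G : Graph) → Fin (n G) → Fin (m G) → Set
Incident G v e = (proj₁ (ends G e) ≡ v) ⊎ (proj₂ (ends G e) ≡ v)

incident? : (G : Graph) → (v : Fin (n G)) → (e : Fin (m G)) → Dec (Incident G v e)
incident? G v e = (proj₁ (ends G e) ≟ᶠ v) ⊎-dec (proj₂ (ends G e) ≟ᶠ v)

incEdges : (G : Graph) → Fin (n G) → List (Fin (m G))
incEdges G v = filter (incident? G v) (allFin (m G))

-- degree (graph is loopless, so this is the number of incident edges)
deg : (G : Graph) → Fin (n G) → ℕ
deg G v = length (incEdges G v)

degrees : (G : Graph) → List ℕ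
degrees G = map (deg G) (allFin (n G))

maxDeg : Graph → ℕ
maxDeg G = foldr _⊔_ 0 (degrees G)

minDeg : Graph → ℕ
minDeg G with degrees G
... | []     = 0
... | d ∷ ds = foldr _⊓_ d ds

IsEdgeColoring : (G : Graph) → (k : ℕ) → (Fin (m G) → Fin k) → Set
IsEdgeColoring G k c =
  ∀ (v : Fin (n G)) (e f : Fin (m G)) →
    Incident G v e → Incident G v f → e ≢ f → c e ≢ c f

palette : (G : Graph) → (k : ℕ) → (Fin (m G) → Fin k) → Fin (n G) → Subset k
palette G k c v =
  tabulate (λ i → any (λ e → ⌊ incident? G v e ×-dec (c e ≟ᶠ i) ⌋) (allFin (m G)))

numPalettes : (G : Graph) → (k : ℕ) → (Fin (m G) → Fin k) → ℕ
numPalettes G k c =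
  length (deduplicate (≡-dec BoolP._≟_) (map (palette G k c) (allFin (n G))))

degIn : (G : Graph) → (Fin (m G) → Bool) → Fin (n G) → ℕ
degIn G S v = length (filter (λ e → BoolP.T? (S e)) (incEdges G v))

HasSpanningEvenNoIsolated : Graph → Set
HasSpanningEvenNoIsolated G =
  ∃[ S ] (∀ (v : Fin (n G)) → (2 ∣ degIn G S v) × (1 ≤ degIn G S v))

-- š(G) > d : every edge-coloring (with any number k of colors) has more than d palettes
PaletteIndexGreaterThan : Graph → ℕ → Set
PaletteIndexGreaterThan G d =
  ∀ (k : ℕ) (c : Fin (m G) → Fin k) → IsEdgeColoring G k c → d < numPalettes G k c

-- Suppose an edge-colouring has p ≤ δ(G) distinct palettes P₁, …, Pₚ. Each palette then has at
-- least p colours, and at least two (if p = 1, the only palette is that of a vertex of degree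
-- Δ(G) ≥ 2). It suffices to find a set A of colours meeting every Pⱼ in an even, nonzero number
-- of colours: since the colours at a vertex are distinct, the edges with colour in A form a
-- spanning even subgraph without isolated vertices.
--
-- Over GF(2) the conditions "|A ∩ Pⱼ| even" are p linear equations, so every set R of more
-- than p colours contains a nonempty even set D (Gaussian elimination), and A ⊕ D stays even.
-- Let A be even of maximum size and suppose A misses some Pⱼ. If the complement ∁A has more
-- than p colours, a nonempty even D ⊆ ∁A enlarges A. Otherwise ∁A = Pⱼ. If some y ∈ A lies in
-- a palette, a nonempty even D ⊆ ∁A ∪ {y} exists; when y ∈ D, the set D ∩ Pⱼ = D - y is even
-- and nonempty, so |D| ≥ 3 and again |A ⊕ D| > |A|. If no colour of A lies in a palette, all
-- palettes equal Pⱼ, and a nonempty even D ⊆ Pⱼ does the job.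

module Submission where

open import Algebra.Bundles using (CommutativeRing)
open import Data.Bool using (Bool; true; false; _∧_; _∨_; _xor_; if_then_else_)
import Data.Bool.Properties as Bool
open import Data.Bool.ListAction using (any; or)
open import Data.Empty using (⊥-elim)
open import Data.Fin using (Fin; zero; suc)
open import Data.Fin.Properties using (_≟_; any?; all?; ¬∀⟶∃¬)
open import Data.Fin.Subset
open import Data.Fin.Subset.Properties
open import Data.List using (List; []; _∷_; length; filter; map; allFin; foldr; deduplicate)
import Data.List as List
open import Data.List.Properties using (map-cong; foldr-preservesᵒ)
open import Data.List.Membership.Propositional using () renaming (_∈_ to _∈ᴸ_)
open import Data.List.Membership.Propositional.Properties
  using (∈-map⁺; ∈-map⁻; ∈-allFin; ∈-lookup; foldr-selective)
open import Data.List.Relation.Unary.All using (All; []; _∷_)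
import Data.List.Relation.Unary.All as All
import Data.List.Relation.Unary.All.Properties as All
open import Data.List.Relation.Unary.AllPairs using (AllPairs; []; _∷_)
import Data.List.Relation.Unary.AllPairs.Properties as AllPairs
open import Data.List.Relation.Unary.Any using (here; there; index)
import Data.List.Relation.Unary.Any as Any
import Data.List.Relation.Unary.Any.Properties as Any
import Data.List.Relation.Unary.Unique.Propositional.Properties as Unique
open import Data.Nat using (ℕ; suc; >-nonZero; _+_; _*_; _∸_; _≤_; _<_; _⊓_; s≤s; z≤n)
open import Data.Nat.Divisibility using (_∣_; divides; ∣⇒≤)
open import Data.Nat.Induction using (<-wellFounded)
import Data.Nat.Properties as ℕ
open import Data.Nat.Tactic.RingSolver using (solve-∀)
open import Data.Product using (_×_; _,_; proj₂; ∃-syntax)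
open import Data.Sum using (_⊎_; inj₁; inj₂; [_,_])
import Data.Sum as Sum
open import Data.Vec using ([]; _∷_; lookup; here; there)
import Data.Vec as Vec
open import Data.Vec.Properties
  using ([]=⇒lookup; ≡-dec; lookup-replicate; lookup-zipWith; tabulate-cong; tabulate∘lookup)
open import Function using (_∘_; case_of_)
open import Induction.WellFounded using (Acc; acc)
open import Relation.Binary.PropositionalEquality
  using (_≡_; _≢_; refl; sym; trans; cong; cong₂; subst; module ≡-Reasoning)
open import Relation.Nullary using (¬_; yes; no; does; contradiction)
open import Relation.Nullary.Decidable using (isYes; isYes≗does; _×-dec_)
open import Relation.Unary using (Decidable)
open import Algebra.Properties.CommutativeSemigroup
  (CommutativeRing.+-commutativeSemigroup Bool.xor-∧-commutativeRing) using (interchange)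

open import Defs hiding (n; m)

private
  variable
    k m n : ℕ
    x : Fin n
    p q : Subset n

infixr 6 _⊕_

_⊕_ : Subset n → Subset n → Subset n
p ⊕ q = Vec.zipWith _xor_ p q

parity : Subset n → Bool
parity []      = false
parity (s ∷ p) = s xor parity p

Even : Subset n → Set
Even p = parity p ≡ false

parity-⊕ : ∀ (p q : Subset n) → parity (p ⊕ q) ≡ parity p xor parity q
parity-⊕ []      []      = refl
parity-⊕ (s ∷ p) (t ∷ q) =
  trans (cong ((s xor t) xor_) (parity-⊕ p q)) (interchange s t (parity p) (parity q))

∩-distribʳ-⊕ : ∀ (p q r : Subset n) → (p ⊕ q) ∩ r ≡ (p ∩ r) ⊕ (q ∩ r)
∩-distribʳ-⊕ []      []      []      = refl
∩-distribʳ-⊕ (s ∷ p) (t ∷ q) (u ∷ r) = cong₂ _∷_ (Bool.∧-distribʳ-xor u s t) (∩-distribʳ-⊕ p q r)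

∩-distribˡ-⊕ : ∀ (p q r : Subset n) → r ∩ (p ⊕ q) ≡ (r ∩ p) ⊕ (r ∩ q)
∩-distribˡ-⊕ []      []      []      = refl
∩-distribˡ-⊕ (s ∷ p) (t ∷ q) (u ∷ r) = cong₂ _∷_ (Bool.∧-distribˡ-xor u s t) (∩-distribˡ-⊕ p q r)

parity-⊥ : ∀ n → parity (⊥ {n}) ≡ false
parity-⊥ ℕ.zero  = refl
parity-⊥ (suc n) = parity-⊥ n

Empty⇒Even : Empty p → Even p
Empty⇒Even {n} p-empty rewrite Empty-unique p-empty = parity-⊥ n

parity-⁅x⁆∩p : ∀ (x : Fin n) p → parity (⁅ x ⁆ ∩ p) ≡ lookup p x
parity-⁅x⁆∩p {suc n} zero    (s ∷ p) rewrite ∩-zeroˡ p | parity-⊥ n = Bool.xor-identityʳ s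
parity-⁅x⁆∩p         (suc x) (s ∷ p) = parity-⁅x⁆∩p x p

parity-[p⊕⁅x⁆]∩q : ∀ (p : Subset n) x q → parity ((p ⊕ ⁅ x ⁆) ∩ q) ≡ parity (p ∩ q) xor lookup q x
parity-[p⊕⁅x⁆]∩q p x q = begin
  parity ((p ⊕ ⁅ x ⁆) ∩ q)              ≡⟨ cong parity (∩-distribʳ-⊕ p ⁅ x ⁆ q) ⟩
  parity ((p ∩ q) ⊕ (⁅ x ⁆ ∩ q))        ≡⟨ parity-⊕ (p ∩ q) (⁅ x ⁆ ∩ q) ⟩
  parity (p ∩ q) xor parity (⁅ x ⁆ ∩ q) ≡⟨ cong (parity (p ∩ q) xor_) (parity-⁅x⁆∩p x q) ⟩
  parity (p ∩ q) xor lookup q x         ∎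
  where open ≡-Reasoning

mutual
  Even⇒2∣∣p∣ : ∀ (p : Subset n) → Even p → 2 ∣ ∣ p ∣
  Even⇒2∣∣p∣ []            _ = divides 0 refl
  Even⇒2∣∣p∣ (outside ∷ p) e = Even⇒2∣∣p∣ p e
  Even⇒2∣∣p∣ (inside  ∷ p) e with parity p in odd | e
  ... | true | _ = odd⇒2∣1+∣p∣ p odd

  odd⇒2∣1+∣p∣ : ∀ (p : Subset n) → parity p ≡ true → 2 ∣ 1 + ∣ p ∣
  odd⇒2∣1+∣p∣ (outside ∷ p) o = odd⇒2∣1+∣p∣ p o
  odd⇒2∣1+∣p∣ (inside  ∷ p) o with parity p in even | o
  ... | false | _ with Even⇒2∣∣p∣ p even
  ...   | divides q eq = divides (suc q) (cong (2 +_) eq)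

0<∣p∣⇒Nonempty : 0 < ∣ p ∣ → Nonempty p
0<∣p∣⇒Nonempty {n} {p} 0<∣p∣ with nonempty? p
... | yes p-nonempty = p-nonempty
... | no  p-empty    = contradiction (trans (cong ∣_∣ (Empty-unique p-empty)) (∣⊥∣≡0 n)) (ℕ.>⇒≢ 0<∣p∣)

Nonempty⇒0<∣p∣ : Nonempty p → 0 < ∣ p ∣
Nonempty⇒0<∣p∣ (_ , x∈p) = ℕ.≤-<-trans z≤n (x∈p⇒∣p-x∣<∣p∣ x∈p)

Even∧Nonempty⇒2≤∣p∣ : Even p → Nonempty p → 2 ≤ ∣ p ∣
Even∧Nonempty⇒2≤∣p∣ {p = p} p-even p-nonempty =
  ∣⇒≤ {{>-nonZero (Nonempty⇒0<∣p∣ p-nonempty)}} (Even⇒2∣∣p∣ p p-even)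

p⊆⁅x⁆⇒∣p∣≤1 : p ⊆ ⁅ x ⁆ → ∣ p ∣ ≤ 1
p⊆⁅x⁆⇒∣p∣≤1 {x = x} p⊆⁅x⁆ = ℕ.≤-trans (p⊆q⇒∣p∣≤∣q∣ p⊆⁅x⁆) (ℕ.≤-reflexive (∣⁅x⁆∣≡1 x))

x∈p⇒∣p∣≡1+∣p-x∣ : x ∈ p → ∣ p ∣ ≡ suc ∣ p - x ∣
x∈p⇒∣p∣≡1+∣p-x∣ {p = inside  ∷ p} here        = cong (suc ∘ ∣_∣) (sym (p─⊥≡p p))
x∈p⇒∣p∣≡1+∣p-x∣ {p = inside  ∷ p} (there x∈p) = cong suc (x∈p⇒∣p∣≡1+∣p-x∣ x∈p)
x∈p⇒∣p∣≡1+∣p-x∣ {p = outside ∷ p} (there x∈p) = x∈p⇒∣p∣≡1+∣p-x∣ x∈p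

x∉p-x : ∀ (p : Subset n) x → x ∉ p - x
x∉p-x (s ∷ p) (suc x) (there x∈p-x) = x∉p-x p x x∈p-x

p⊆q∧∣q∣≤∣p∣⇒q⊆p : p ⊆ q → ∣ q ∣ ≤ ∣ p ∣ → q ⊆ p
p⊆q∧∣q∣≤∣p∣⇒q⊆p {p = p} p⊆q ∣q∣≤∣p∣ {x} x∈q with x ∈? p
... | yes x∈p = x∈p
... | no  x∉p = contradiction (p⊂q⇒∣p∣<∣q∣ (p⊆q , x , x∈q , x∉p)) (ℕ.≤⇒≯ ∣q∣≤∣p∣)

p⊆q⇒p∩q≡p : p ⊆ q → p ∩ q ≡ p
p⊆q⇒p∩q≡p {p = p} {q} p⊆q = ⊆-antisym (p∩q⊆p p q) (λ x∈p → x∈p∩q⁺ (x∈p , p⊆q x∈p))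

Empty[p∩q]⇒q⊆∁p : Empty (p ∩ q) → q ⊆ ∁ p
Empty[p∩q]⇒q⊆∁p p∩q-empty x∈q = x∉p⇒x∈∁p (λ x∈p → p∩q-empty (_ , x∈p∩q⁺ (x∈p , x∈q)))

x∈p⊕q⁻ : ∀ (p q : Subset n) → x ∈ p ⊕ q → x ∈ p ⊎ x ∈ q
x∈p⊕q⁻ (inside  ∷ p) (outside ∷ q) here      = inj₁ here
x∈p⊕q⁻ (outside ∷ p) (inside  ∷ q) here      = inj₂ here
x∈p⊕q⁻ (s       ∷ p) (t       ∷ q) (there m) = Sum.map there there (x∈p⊕q⁻ p q m)

x∈p⊕q⁺ : ∀ (p q : Subset n) → x ∈ p × x ∉ q ⊎ x ∉ p × x ∈ q → x ∈ p ⊕ q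
x∈p⊕q⁺ (inside  ∷ p) (outside ∷ q) (inj₁ (here , _))       = here
x∈p⊕q⁺ (inside  ∷ p) (inside  ∷ q) (inj₁ (here , x∉q))     = contradiction here x∉q
x∈p⊕q⁺ (outside ∷ p) (inside  ∷ q) (inj₂ (_ , here))       = here
x∈p⊕q⁺ (inside  ∷ p) (inside  ∷ q) (inj₂ (x∉p , here))     = contradiction here x∉p
x∈p⊕q⁺ (s ∷ p) (t ∷ q) (inj₁ (there x∈p , x∉q)) = there (x∈p⊕q⁺ p q (inj₁ (x∈p , x∉q ∘ there)))
x∈p⊕q⁺ (s ∷ p) (t ∷ q) (inj₂ (x∉p , there x∈q)) = there (x∈p⊕q⁺ p q (inj₂ (x∉p ∘ there , x∈q)))

x∈p⊕⁅y⁆⁻ : ∀ {p : Subset n} {x y} → x ∈ p ⊕ ⁅ y ⁆ → x ∈ p ⊎ x ≡ y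
x∈p⊕⁅y⁆⁻ {p = p} {y = y} = Sum.map₂ (x∈⁅y⁆⇒x≡y y) ∘ x∈p⊕q⁻ p ⁅ y ⁆

∣p⊕q∣+2∣p∩q∣≡∣p∣+∣q∣ : ∀ (p q : Subset n) → ∣ p ⊕ q ∣ + 2 * ∣ p ∩ q ∣ ≡ ∣ p ∣ + ∣ q ∣
∣p⊕q∣+2∣p∩q∣≡∣p∣+∣q∣ []            []            = refl
∣p⊕q∣+2∣p∩q∣≡∣p∣+∣q∣ (outside ∷ p) (outside ∷ q) = ∣p⊕q∣+2∣p∩q∣≡∣p∣+∣q∣ p q
∣p⊕q∣+2∣p∩q∣≡∣p∣+∣q∣ (inside  ∷ p) (outside ∷ q) = cong suc (∣p⊕q∣+2∣p∩q∣≡∣p∣+∣q∣ p q)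
∣p⊕q∣+2∣p∩q∣≡∣p∣+∣q∣ (outside ∷ p) (inside  ∷ q) =
  trans (cong suc (∣p⊕q∣+2∣p∩q∣≡∣p∣+∣q∣ p q)) (sym (ℕ.+-suc (∣ p ∣) (∣ q ∣)))
∣p⊕q∣+2∣p∩q∣≡∣p∣+∣q∣ (inside  ∷ p) (inside  ∷ q) = begin
  ∣ p ⊕ q ∣ + 2 * suc ∣ p ∩ q ∣    ≡⟨ shift (∣ p ⊕ q ∣) (∣ p ∩ q ∣) ⟩
  2 + (∣ p ⊕ q ∣ + 2 * ∣ p ∩ q ∣)  ≡⟨ cong (2 +_) (∣p⊕q∣+2∣p∩q∣≡∣p∣+∣q∣ p q) ⟩
  2 + (∣ p ∣ + ∣ q ∣)              ≡⟨ cong suc (sym (ℕ.+-suc (∣ p ∣) (∣ q ∣))) ⟩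
  suc ∣ p ∣ + suc ∣ q ∣            ∎
  where
  open ≡-Reasoning
  shift : ∀ a c → a + 2 * suc c ≡ 2 + (a + 2 * c)
  shift = solve-∀

∣p∣<∣p⊕q∣ : ∀ (p q : Subset n) → 2 * ∣ p ∩ q ∣ < ∣ q ∣ → ∣ p ∣ < ∣ p ⊕ q ∣
∣p∣<∣p⊕q∣ p q 2∣p∩q∣<∣q∣ = ℕ.+-cancelʳ-< (∣ q ∣) (∣ p ∣) (∣ p ⊕ q ∣) (begin-strict
  ∣ p ∣ + ∣ q ∣               ≡⟨ ∣p⊕q∣+2∣p∩q∣≡∣p∣+∣q∣ p q ⟨
  ∣ p ⊕ q ∣ + 2 * ∣ p ∩ q ∣   <⟨ ℕ.+-monoʳ-< (∣ p ⊕ q ∣) 2∣p∩q∣<∣q∣ ⟩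
  ∣ p ⊕ q ∣ + ∣ q ∣           ∎)
  where open ℕ.≤-Reasoning

disjoint⇒2∣p∩q∣<∣q∣ : ∀ (p : Subset n) {q} → (∀ {x} → x ∈ q → x ∉ p) → Nonempty q →
                       2 * ∣ p ∩ q ∣ < ∣ q ∣
disjoint⇒2∣p∩q∣<∣q∣ {n} p {q} q-avoids-p q-nonempty
  rewrite Empty-unique {p = p ∩ q} (λ (_ , x∈p∩q) → let x∈p , x∈q = x∈p∩q⁻ p q x∈p∩q in q-avoids-p x∈q x∈p)
        | ∣⊥∣≡0 n = Nonempty⇒0<∣p∣ q-nonempty

EvenOn : ∀ {p} → (Fin p → Subset n) → Subset n → Set
EvenOn P A = ∀ j → Even (A ∩ P j)

Covers : ∀ {p} → (Fin p → Subset n) → Subset n → Set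
Covers P A = ∀ j → Nonempty (A ∩ P j)

EvenOn-⊕ : ∀ {p} (P : Fin p → Subset n) {A D} → EvenOn P A → EvenOn P D → EvenOn P (A ⊕ D)
EvenOn-⊕ P {A} {D} A-even D-even j = begin
  parity ((A ⊕ D) ∩ P j)                ≡⟨ cong parity (∩-distribʳ-⊕ A D (P j)) ⟩
  parity ((A ∩ P j) ⊕ (D ∩ P j))        ≡⟨ parity-⊕ (A ∩ P j) (D ∩ P j) ⟩
  parity (A ∩ P j) xor parity (D ∩ P j) ≡⟨ cong₂ _xor_ (A-even j) (D-even j) ⟩
  false                                 ∎
  where open ≡-Reasoning

-- A pivot step of Gaussian elimination over GF(2), with pivot u ∈ P: `eliminate` clears u from
-- the other sets Q, and `restore` adds u back to a solution D exactly when D is odd on P.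

eliminate : Fin n → Subset n → Subset n → Subset n
eliminate u P Q = if lookup Q u then Q ⊕ P else Q

restore : Fin n → Subset n → Subset n → Subset n
restore u P D = if parity (D ∩ P) then D ⊕ ⁅ u ⁆ else D

parity-∩-eliminate : ∀ (D : Subset n) u P Q →
  parity (D ∩ eliminate u P Q) ≡ parity (D ∩ Q) xor (lookup Q u ∧ parity (D ∩ P))
parity-∩-eliminate D u P Q with lookup Q u
... | true  = trans (cong parity (∩-distribˡ-⊕ Q P D)) (parity-⊕ (D ∩ Q) (D ∩ P))
... | false = sym (Bool.xor-identityʳ (parity (D ∩ Q)))

parity-∩-restore : ∀ (D : Subset n) u P Q →
  parity (restore u P D ∩ Q) ≡ parity (D ∩ Q) xor (lookup Q u ∧ parity (D ∩ P))
parity-∩-restore D u P Q with parity (D ∩ P)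
... | true  = trans (parity-[p⊕⁅x⁆]∩q D u Q) (cong (parity (D ∩ Q) xor_) (sym (Bool.∧-identityʳ _)))
... | false = trans (sym (Bool.xor-identityʳ _)) (cong (parity (D ∩ Q) xor_) (sym (Bool.∧-zeroʳ _)))

restore-⊇ : ∀ {u} (P D : Subset n) → u ∉ D → D ⊆ restore u P D
restore-⊇ {u = u} P D u∉D {x} x∈D with parity (D ∩ P)
... | true  = x∈p⊕q⁺ D ⁅ u ⁆ (inj₁ (x∈D , λ x∈⁅u⁆ → u∉D (subst (_∈ D) (x∈⁅y⁆⇒x≡y u x∈⁅u⁆) x∈D)))
... | false = x∈D

restore-⊆ : ∀ {u} (P D : Subset n) {R} → u ∈ R → D ⊆ R → restore u P D ⊆ R
restore-⊆ {u = u} P D u∈R D⊆R x∈restore with parity (D ∩ P)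
... | false = D⊆R x∈restore
... | true with x∈p⊕⁅y⁆⁻ x∈restore
...   | inj₁ x∈D  = D⊆R x∈D
...   | inj₂ refl = u∈R

restore-even : ∀ {p u} (P : Fin (suc p) → Subset n) D → u ∈ P zero →
  EvenOn (λ j → eliminate u (P zero) (P (suc j))) D → EvenOn P (restore u (P zero) D)
restore-even {u = u} P D u∈P₀ D-even zero = begin
  parity (restore u P₀ D ∩ P₀)                        ≡⟨ parity-∩-restore D u P₀ P₀ ⟩
  parity (D ∩ P₀) xor (lookup P₀ u ∧ parity (D ∩ P₀)) ≡⟨ cong (λ b → parity (D ∩ P₀) xor (b ∧ parity (D ∩ P₀)))
                                                                ([]=⇒lookup u∈P₀) ⟩
  parity (D ∩ P₀) xor parity (D ∩ P₀)                 ≡⟨ Bool.xor-same (parity (D ∩ P₀)) ⟩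
  false                                               ∎
  where
  open ≡-Reasoning
  P₀ = P zero
restore-even {u = u} P D u∈P₀ D-even (suc j) = begin
  parity (restore u (P zero) D ∩ P (suc j))     ≡⟨ parity-∩-restore D u (P zero) (P (suc j)) ⟩
  _                                             ≡⟨ parity-∩-eliminate D u (P zero) (P (suc j)) ⟨
  parity (D ∩ eliminate u (P zero) (P (suc j))) ≡⟨ D-even j ⟩
  false                                         ∎
  where open ≡-Reasoning

∃-even-subset : ∀ {p} (P : Fin p → Subset n) {R} → p < ∣ R ∣ →
                ∃[ D ] D ⊆ R × Nonempty D × EvenOn P D
∃-even-subset {p = 0} P 0<∣R∣ with 0<∣p∣⇒Nonempty 0<∣R∣
... | x , x∈R = ⁅ x ⁆ , (λ y∈⁅x⁆ → subst (_∈ _) (sym (x∈⁅y⁆⇒x≡y x y∈⁅x⁆)) x∈R) , (x , x∈⁅x⁆ x) , λ ()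
∃-even-subset {p = suc p} P {R} p<∣R∣ with nonempty? (R ∩ P zero)
... | no R∩P₀-empty =
  let D , D⊆R , D-nonempty , D-even = ∃-even-subset (P ∘ suc) (ℕ.<-trans (ℕ.n<1+n p) p<∣R∣)
      D∩P₀-empty : Empty (D ∩ P zero)
      D∩P₀-empty (x , x∈D∩P₀) = let x∈D , x∈P₀ = x∈p∩q⁻ D (P zero) x∈D∩P₀ in
        R∩P₀-empty (x , x∈p∩q⁺ (D⊆R x∈D , x∈P₀))
  in D , D⊆R , D-nonempty , λ { zero → Empty⇒Even D∩P₀-empty ; (suc j) → D-even j }
... | yes (u , u∈R∩P₀) =
  let u∈R , u∈P₀ = x∈p∩q⁻ R (P zero) u∈R∩P₀
      D , D⊆R-u , (x , x∈D) , D-even =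
        ∃-even-subset (λ j → eliminate u (P zero) (P (suc j)))
          (ℕ.≤-pred (subst (_ <_) (x∈p⇒∣p∣≡1+∣p-x∣ u∈R) p<∣R∣))
      u∉D = λ u∈D → x∉p-x R u (D⊆R-u u∈D)
  in restore u (P zero) D , restore-⊆ (P zero) D u∈R (p─q⊆p R ⁅ u ⁆ ∘ D⊆R-u)
   , (x , restore-⊇ (P zero) D u∉D x∈D) , restore-even P D u∈P₀ D-even

module _ {p} (P : Fin p → Subset n) (p≤∣P∣ : ∀ j → p ≤ ∣ P j ∣) (2≤∣P∣ : ∀ j → 2 ≤ ∣ P j ∣) where

  -- D augments A: by EvenOn-⊕ and ∣p∣<∣p⊕q∣, A ⊕ D is even (if A is) and larger than A.
  Augments : Subset n → Subset n → Set
  Augments A D = EvenOn P D × 2 * ∣ A ∩ D ∣ < ∣ D ∣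

  small-∁⇒∁⊆P : ∀ {A j} → Empty (A ∩ P j) → ∣ ∁ A ∣ ≤ p → ∁ A ⊆ P j
  small-∁⇒∁⊆P {j = j} A∩Pj-empty ∣∁A∣≤p =
    p⊆q∧∣q∣≤∣p∣⇒q⊆p (Empty[p∩q]⇒q⊆∁p A∩Pj-empty) (ℕ.≤-trans ∣∁A∣≤p (p≤∣P∣ j))

  -- As ∁ A ⊆ Pⱼ ∌ y, D ∩ Pⱼ = D - y; it is even, and nonempty (else D ∩ Pᵢ = {y} would be
  -- odd), so ∣ D ∣ ≥ 3 while ∣ A ∩ D ∣ ≤ 1.
  augments-through : ∀ {A D i j y} → Empty (A ∩ P j) → ∁ A ⊆ P j → y ∈ A → y ∈ P i →
                     D ⊆ ∁ A ⊕ ⁅ y ⁆ → y ∈ D → EvenOn P D → 2 * ∣ A ∩ D ∣ < ∣ D ∣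
  augments-through {A} {D} {i} {j} {y} A∩Pj-empty ∁A⊆Pj y∈A y∈Pi D⊆R y∈D D-even =
    ℕ.≤-<-trans (ℕ.*-monoʳ-≤ 2 ∣A∩D∣≤1)
      (ℕ.≤-<-trans (Even∧Nonempty⇒2≤∣p∣ (D-even j) T-nonempty) (p⊂q⇒∣p∣<∣q∣ T⊂D))
    where
    ∣A∩D∣≤1 : ∣ A ∩ D ∣ ≤ 1
    ∣A∩D∣≤1 = p⊆⁅x⁆⇒∣p∣≤1 {x = y} λ x∈A∩D → let x∈A , x∈D = x∈p∩q⁻ A D x∈A∩D in
      case x∈p⊕⁅y⁆⁻ (D⊆R x∈D) of λ where
        (inj₁ x∈∁A) → contradiction x∈A (x∈∁p⇒x∉p x∈∁A)
        (inj₂ refl) → x∈⁅x⁆ y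
    T = D ∩ P j
    T⊂D : T ⊂ D
    T⊂D = p∩q⊆p D (P j) , y , y∈D , λ y∈T → A∩Pj-empty (y , x∈p∩q⁺ (y∈A , proj₂ (x∈p∩q⁻ D (P j) y∈T)))
    T-nonempty : Nonempty T
    T-nonempty with nonempty? T
    ... | yes T-nonempty = T-nonempty
    ... | no  T-empty    =
      contradiction ∣D∩Pi∣≤1 (ℕ.<⇒≱ (Even∧Nonempty⇒2≤∣p∣ (D-even i) (y , x∈p∩q⁺ (y∈D , y∈Pi))))
      where
      ∣D∩Pi∣≤1 : ∣ D ∩ P i ∣ ≤ 1
      ∣D∩Pi∣≤1 = p⊆⁅x⁆⇒∣p∣≤1 {x = y} λ x∈D∩Pi → let x∈D , _ = x∈p∩q⁻ D (P i) x∈D∩Pi in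
        case x∈p⊕⁅y⁆⁻ (D⊆R x∈D) of λ where
          (inj₁ x∈∁A) → ⊥-elim (T-empty (_ , x∈p∩q⁺ (x∈D , ∁A⊆Pj x∈∁A)))
          (inj₂ refl) → x∈⁅x⁆ y

  augmenting-through : ∀ {A i j y} → Empty (A ∩ P j) → ∁ A ⊆ P j → y ∈ A → y ∈ P i →
                       ∃[ D ] Augments A D
  augmenting-through {A} {i} {j} {y} A∩Pj-empty ∁A⊆Pj y∈A y∈Pi =
    let D , D⊆R , D-nonempty , D-even = ∃-even-subset P p<∣R∣
    in D , D-even , (case y ∈? D of λ where
      (yes y∈D) → augments-through A∩Pj-empty ∁A⊆Pj y∈A y∈Pi D⊆R y∈D D-even
      (no  y∉D) → disjoint⇒2∣p∩q∣<∣q∣ A (λ x∈D → case x∈p⊕⁅y⁆⁻ (D⊆R x∈D) of λ where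
        (inj₁ x∈∁A) → x∈∁p⇒x∉p x∈∁A
        (inj₂ refl) → contradiction x∈D y∉D) D-nonempty)
    where
    R = ∁ A ⊕ ⁅ y ⁆
    ⁅y⁆-avoids-∁A : ∀ {x} → x ∈ ⁅ y ⁆ → x ∉ ∁ A
    ⁅y⁆-avoids-∁A x∈⁅y⁆ = x∈p⇒x∉∁p (subst (_∈ A) (sym (x∈⁅y⁆⇒x≡y y x∈⁅y⁆)) y∈A)
    p<∣R∣ : p < ∣ R ∣
    p<∣R∣ = ℕ.≤-<-trans (ℕ.≤-trans (p≤∣P∣ j) (p⊆q⇒∣p∣≤∣q∣ (Empty[p∩q]⇒q⊆∁p A∩Pj-empty)))
              (∣p∣<∣p⊕q∣ (∁ A) ⁅ y ⁆ (disjoint⇒2∣p∩q∣<∣q∣ (∁ A) ⁅y⁆-avoids-∁A (y , x∈⁅x⁆ y)))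

  augmenting-common : ∀ {A} j → ∣ ∁ A ∣ ≤ p → (∀ i → Empty (A ∩ P i)) → ∃[ D ] Augments A D
  augmenting-common {A} j ∣∁A∣≤p A∩P-empty =
    let D , D⊆Pj , D-nonempty , D-even = ∃-even-subset (λ (_ : Fin 1) → P j) (2≤∣P∣ j)
    in D , even-everywhere D⊆Pj (D-even zero)
     , disjoint⇒2∣p∩q∣<∣q∣ A (x∈∁p⇒x∉p ∘ Empty[p∩q]⇒q⊆∁p (A∩P-empty j) ∘ D⊆Pj) D-nonempty
    where
    Pj⊆P : ∀ i → P j ⊆ P i
    Pj⊆P i = p⊆q∧∣q∣≤∣p∣⇒q⊆p (small-∁⇒∁⊆P (A∩P-empty j) ∣∁A∣≤p ∘ Empty[p∩q]⇒q⊆∁p (A∩P-empty i))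
      (ℕ.≤-trans (p⊆q⇒∣p∣≤∣q∣ (Empty[p∩q]⇒q⊆∁p (A∩P-empty j))) (ℕ.≤-trans ∣∁A∣≤p (p≤∣P∣ i)))
    even-everywhere : ∀ {D} → D ⊆ P j → Even (D ∩ P j) → EvenOn P D
    even-everywhere D⊆Pj D-even i =
      subst Even (trans (p⊆q⇒p∩q≡p D⊆Pj) (sym (p⊆q⇒p∩q≡p (Pj⊆P i ∘ D⊆Pj)))) D-even

  augmenting : ∀ A j → Empty (A ∩ P j) → ∃[ D ] Augments A D
  augmenting A j A∩Pj-empty with p ℕ.<? ∣ ∁ A ∣
  ... | yes p<∣∁A∣ =
    let D , D⊆∁A , D-nonempty , D-even = ∃-even-subset P p<∣∁A∣
    in D , D-even , disjoint⇒2∣p∩q∣<∣q∣ A (x∈∁p⇒x∉p ∘ D⊆∁A) D-nonempty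
  ... | no p≮∣∁A∣ with any? (λ i → nonempty? (A ∩ P i))
  ...   | yes (i , y , y∈A∩Pi) = let y∈A , y∈Pi = x∈p∩q⁻ A (P i) y∈A∩Pi in
    augmenting-through A∩Pj-empty (small-∁⇒∁⊆P A∩Pj-empty (ℕ.≮⇒≥ p≮∣∁A∣)) y∈A y∈Pi
  ...   | no  A-misses-P = augmenting-common j (ℕ.≮⇒≥ p≮∣∁A∣)
    λ i (x , x∈A∩Pi) → A-misses-P (i , x , x∈A∩Pi)

  ∃-even-cover : ∃[ A ] EvenOn P A × Covers P A
  ∃-even-cover = grow ⊥ ⊥-even (<-wellFounded (n ∸ ∣ ⊥ {n} ∣))
    where
    ⊥-even : EvenOn P ⊥
    ⊥-even j = subst Even (sym (∩-zeroˡ (P j))) (parity-⊥ n)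
    grow : ∀ A → EvenOn P A → Acc _<_ (n ∸ ∣ A ∣) → ∃[ A' ] EvenOn P A' × Covers P A'
    grow A A-even (acc rs) with all? (λ j → nonempty? (A ∩ P j))
    ... | yes A-covers = A , A-even , A-covers
    ... | no ¬A-covers =
      let j , A∩Pj-empty = ¬∀⟶∃¬ p _ (λ j → nonempty? (A ∩ P j)) ¬A-covers
          D , D-even , 2∣A∩D∣<∣D∣ = augmenting A j A∩Pj-empty
      in grow (A ⊕ D) (EvenOn-⊕ P {A} {D} A-even D-even)
              (rs (ℕ.∸-monoʳ-< (∣p∣<∣p⊕q∣ A D 2∣A∩D∣<∣D∣) (∣p∣≤n (A ⊕ D))))

lookup-⁅x⁆ : ∀ (x i : Fin n) → lookup ⁅ x ⁆ i ≡ does (x ≟ i)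
lookup-⁅x⁆ zero    zero    = refl
lookup-⁅x⁆ zero    (suc i) = lookup-replicate i outside
lookup-⁅x⁆ (suc x) zero    = refl
lookup-⁅x⁆ (suc x) (suc i) = lookup-⁅x⁆ x i

p∩⁅x⁆≡ : ∀ (p : Subset n) x → p ∩ ⁅ x ⁆ ≡ (if lookup p x then ⁅ x ⁆ else ⊥)
p∩⁅x⁆≡ (s ∷ p) zero rewrite ∩-zeroʳ p with s
... | true  = refl
... | false = refl
p∩⁅x⁆≡ (s ∷ p) (suc x) rewrite Bool.∧-zeroʳ s | p∩⁅x⁆≡ p x with lookup p x
... | true  = refl
... | false = refl

p∩[⁅x⁆∪q]≡ : ∀ (p : Subset n) x q →
  p ∩ (⁅ x ⁆ ∪ q) ≡ (if lookup p x then ⁅ x ⁆ ∪ (p ∩ q) else p ∩ q)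
p∩[⁅x⁆∪q]≡ p x q rewrite ∩-distribˡ-∪ p ⁅ x ⁆ q | p∩⁅x⁆≡ p x with lookup p x
... | true  = refl
... | false = ∪-identityˡ (p ∩ q)

x∉p⇒∣⁅x⁆∪p∣≡1+∣p∣ : x ∉ p → ∣ ⁅ x ⁆ ∪ p ∣ ≡ suc ∣ p ∣
x∉p⇒∣⁅x⁆∪p∣≡1+∣p∣ {x = zero}  {p = outside ∷ p} _   = cong (suc ∘ ∣_∣) (∪-identityˡ p)
x∉p⇒∣⁅x⁆∪p∣≡1+∣p∣ {x = zero}  {p = inside  ∷ p} x∉p = contradiction here x∉p
x∉p⇒∣⁅x⁆∪p∣≡1+∣p∣ {x = suc x} {p = outside ∷ p} x∉p = x∉p⇒∣⁅x⁆∪p∣≡1+∣p∣ (x∉p ∘ there)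
x∉p⇒∣⁅x⁆∪p∣≡1+∣p∣ {x = suc x} {p = inside  ∷ p} x∉p = cong suc (x∉p⇒∣⁅x⁆∪p∣≡1+∣p∣ (x∉p ∘ there))

colours : (Fin m → Fin k) → List (Fin m) → Subset k
colours c []       = ⊥
colours c (e ∷ es) = ⁅ c e ⁆ ∪ colours c es

Rainbow : (Fin m → Fin k) → List (Fin m) → Set
Rainbow c = AllPairs (λ e f → c e ≢ c f)

lookup-colours : ∀ (c : Fin m → Fin k) es i → lookup (colours c es) i ≡ any (λ e → does (c e ≟ i)) es
lookup-colours c []       i = lookup-replicate i outside
lookup-colours c (e ∷ es) i = begin
  lookup (⁅ c e ⁆ ∪ colours c es) i              ≡⟨ lookup-zipWith _∨_ i ⁅ c e ⁆ (colours c es) ⟩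
  lookup ⁅ c e ⁆ i ∨ lookup (colours c es) i     ≡⟨ cong₂ _∨_ (lookup-⁅x⁆ (c e) i) (lookup-colours c es i) ⟩
  does (c e ≟ i) ∨ any (λ e → does (c e ≟ i)) es ∎
  where open ≡-Reasoning

x∉colours : ∀ (c : Fin m → Fin k) {x es} → All (λ f → x ≢ c f) es → x ∉ colours c es
x∉colours c []                     x∈⊥ = ∉⊥ x∈⊥
x∉colours c {es = f ∷ es} (x≢cf ∷ x∉es) x∈colours with x∈p∪q⁻ ⁅ c f ⁆ (colours c es) x∈colours
... | inj₁ x∈⁅cf⁆ = x≢cf (x∈⁅y⁆⇒x≡y (c f) x∈⁅cf⁆)
... | inj₂ x∈es   = x∉colours c x∉es x∈es

∣colours∣≡length : ∀ (c : Fin m → Fin k) {es} → Rainbow c es → ∣ colours c es ∣ ≡ length es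
∣colours∣≡length {k = k} c []                 = ∣⊥∣≡0 k
∣colours∣≡length         c (ce∉ces ∷ rainbow) =
  trans (x∉p⇒∣⁅x⁆∪p∣≡1+∣p∣ (x∉colours c ce∉ces)) (cong suc (∣colours∣≡length c rainbow))

colours-filter : ∀ (c : Fin m → Fin k) A es →
  colours c (filter (λ e → Bool.T? (lookup A (c e))) es) ≡ A ∩ colours c es
colours-filter c A []       = sym (∩-zeroʳ A)
colours-filter c A (e ∷ es) rewrite p∩[⁅x⁆∪q]≡ A (c e) (colours c es) with lookup A (c e)
... | true  = cong (⁅ c e ⁆ ∪_) (colours-filter c A es)
... | false = colours-filter c A es

any-filter : ∀ {A : Set} {P : A → Set} (P? : Decidable P) (f : A → Bool) xs →
  any (λ x → does (P? x) ∧ f x) xs ≡ any f (filter P? xs)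
any-filter P? f []       = refl
any-filter P? f (x ∷ xs) with does (P? x)
... | true  = cong (f x ∨_) (any-filter P? f xs)
... | false = any-filter P? f xs

foldr-⊓-≤ : ∀ {x} d ds → x ∈ᴸ d ∷ ds → foldr _⊓_ d ds ≤ x
foldr-⊓-≤ d ds x∈d∷ds = foldr-preservesᵒ (λ a b → [ ℕ.m≤n⇒m⊓o≤n b , ℕ.m≤n⇒o⊓m≤n a ]) d ds
  (case x∈d∷ds of λ where
    (here x≡d)   → inj₁ (ℕ.≤-reflexive (sym x≡d))
    (there x∈ds) → inj₂ (Any.map (ℕ.≤-reflexive ∘ sym) x∈ds))

deg∈degrees : ∀ G v → deg G v ∈ᴸ degrees G
deg∈degrees G v = ∈-map⁺ (deg G) (∈-allFin v)

minDeg≤deg : ∀ G v → minDeg G ≤ deg G v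
minDeg≤deg G v with degrees G | deg∈degrees G v
... | d ∷ ds | dv∈degrees = foldr-⊓-≤ d ds dv∈degrees

∃-deg≥2 : ∀ G → 2 ≤ maxDeg G → ∃[ w ] 2 ≤ deg G w
∃-deg≥2 G 2≤Δ with foldr-selective ℕ.⊔-sel 0 (degrees G)
... | inj₁ Δ≡0       = contradiction (subst (2 ≤_) Δ≡0 2≤Δ) λ ()
... | inj₂ Δ∈degrees = let w , _ , Δ≡deg = ∈-map⁻ (deg G) Δ∈degrees in w , subst (2 ≤_) Δ≡deg 2≤Δ

Fin-subsingleton : ∀ {p} → p ≤ 1 → (i j : Fin p) → i ≡ j
Fin-subsingleton (s≤s z≤n) zero zero = refl

module _ (G : Graph) {k} (c : Fin (Graph.m G) → Fin k) where

  palette≡colours : ∀ v → palette G k c v ≡ colours c (incEdges G v)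
  palette≡colours v = trans (tabulate-cong lookup-palette) (tabulate∘lookup _)
    where
    lookup-palette : ∀ i → _ ≡ lookup (colours c (incEdges G v)) i
    lookup-palette i = begin
      any (λ e → isYes (incident? G v e ×-dec (c e ≟ i))) (allFin _)
        ≡⟨ cong or (map-cong (λ e → isYes≗does (incident? G v e ×-dec (c e ≟ i))) (allFin _)) ⟩
      any (λ e → does (incident? G v e) ∧ does (c e ≟ i)) (allFin _)
        ≡⟨ any-filter (incident? G v) (λ e → does (c e ≟ i)) (allFin _) ⟩
      any (λ e → does (c e ≟ i)) (incEdges G v)
        ≡⟨ lookup-colours c (incEdges G v) i ⟨
      lookup (colours c (incEdges G v)) i
        ∎
      where open ≡-Reasoning

  palettes : List (Subset k)
  palettes = deduplicate (≡-dec Bool._≟_) (map (palette G k c) (allFin _))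

  distinct-palette : Fin (numPalettes G k c) → Subset k
  distinct-palette = List.lookup palettes

  distinct-palette-of : ∀ j → ∃[ v ] distinct-palette j ≡ palette G k c v
  distinct-palette-of j =
    let v , _ , eq = ∈-map⁻ (palette G k c) (Any.deduplicate⁻ (≡-dec Bool._≟_) (∈-lookup {xs = palettes} j))
    in v , eq

  index-of-palette : ∀ v → ∃[ j ] distinct-palette j ≡ palette G k c v
  index-of-palette v = index palette∈palettes , sym (Any.lookup-index palette∈palettes)
    where
    palette∈palettes : palette G k c v ∈ᴸ palettes
    palette∈palettes = Any.deduplicate⁺ (≡-dec Bool._≟_) (λ eq pa → trans pa (sym eq))
                         (∈-map⁺ (palette G k c) (∈-allFin v))

  module _ (proper : IsEdgeColoring G k c) where

    incEdges-rainbow : ∀ v → Rainbow c (incEdges G v)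
    incEdges-rainbow v = rainbow (All.all-filter (incident? G v) (allFin _))
                                 (Unique.filter⁺ (incident? G v) (Unique.allFin⁺ _))
      where
      rainbow : ∀ {es} → All (Incident G v) es → AllPairs _≢_ es → Rainbow c es
      rainbow []               []                   = []
      rainbow (e-inc ∷ es-inc) (e∉es ∷ es-distinct) =
        All.zipWith (λ (f-inc , e≢f) → proper v _ _ e-inc f-inc e≢f) (es-inc , e∉es)
        ∷ rainbow es-inc es-distinct

    deg≡∣palette∣ : ∀ v → deg G v ≡ ∣ palette G k c v ∣
    deg≡∣palette∣ v =
      sym (trans (cong ∣_∣ (palette≡colours v)) (∣colours∣≡length c (incEdges-rainbow v)))

    degIn≡∣A∩palette∣ : ∀ A v → degIn G (λ e → lookup A (c e)) v ≡ ∣ A ∩ palette G k c v ∣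
    degIn≡∣A∩palette∣ A v = begin
      length (filter (λ e → Bool.T? (lookup A (c e))) (incEdges G v))
        ≡⟨ ∣colours∣≡length c (AllPairs.filter⁺ _ (incEdges-rainbow v)) ⟨
      ∣ colours c (filter (λ e → Bool.T? (lookup A (c e))) (incEdges G v)) ∣
        ≡⟨ cong ∣_∣ (colours-filter c A (incEdges G v)) ⟩
      ∣ A ∩ colours c (incEdges G v) ∣
        ≡⟨ cong (λ P → ∣ A ∩ P ∣) (palette≡colours v) ⟨
      ∣ A ∩ palette G k c v ∣
        ∎
      where open ≡-Reasoning

    even-cover⇒spanning-even : ∀ A → EvenOn distinct-palette A → Covers distinct-palette A →
                               HasSpanningEvenNoIsolated G
    even-cover⇒spanning-even A A-even A-covers = (λ e → lookup A (c e)) , λ v →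
      let j , Pj≡ = index-of-palette v
          ∣A∩Pj∣≡degIn = trans (cong (λ P → ∣ A ∩ P ∣) Pj≡) (sym (degIn≡∣A∩palette∣ A v))
      in subst (2 ∣_) ∣A∩Pj∣≡degIn (Even⇒2∣∣p∣ (A ∩ distinct-palette j) (A-even j))
       , subst (1 ≤_) ∣A∩Pj∣≡degIn (Nonempty⇒0<∣p∣ (A-covers j))

    spanning-even-subgraph : 2 ≤ maxDeg G → numPalettes G k c ≤ minDeg G →
                             HasSpanningEvenNoIsolated G
    spanning-even-subgraph 2≤Δ p≤δ =
      let A , A-even , A-covers = ∃-even-cover P p≤∣P∣ 2≤∣P∣
      in even-cover⇒spanning-even A A-even A-covers
      where
      P = distinct-palette
      ∣P∣≡deg : ∀ {j v} → P j ≡ palette G k c v → ∣ P j ∣ ≡ deg G v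
      ∣P∣≡deg Pj≡ = trans (cong ∣_∣ Pj≡) (sym (deg≡∣palette∣ _))
      p≤∣P∣ : ∀ j → numPalettes G k c ≤ ∣ P j ∣
      p≤∣P∣ j = let v , Pj≡ = distinct-palette-of j in
        ℕ.≤-trans p≤δ (ℕ.≤-trans (minDeg≤deg G v) (ℕ.≤-reflexive (sym (∣P∣≡deg Pj≡))))
      2≤∣P∣ : ∀ j → 2 ≤ ∣ P j ∣
      2≤∣P∣ j with 2 ℕ.≤? numPalettes G k c
      ... | yes 2≤p = ℕ.≤-trans 2≤p (p≤∣P∣ j)
      ... | no  2≰p =
        let w , 2≤deg = ∃-deg≥2 G 2≤Δ
            i , Pi≡   = index-of-palette w
        in subst (λ i → 2 ≤ ∣ P i ∣) (Fin-subsingleton (ℕ.≤-pred (ℕ.≰⇒> 2≰p)) i j)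
             (subst (2 ≤_) (sym (∣P∣≡deg Pi≡)) 2≤deg)

theorem2 : (G : Graph) → 2 ≤ maxDeg G → ¬ HasSpanningEvenNoIsolated G →
    PaletteIndexGreaterThan G (minDeg G)
theorem2 G 2≤Δ no-even-subgraph k c proper =
  ℕ.≰⇒> (no-even-subgraph ∘ spanning-even-subgraph G c proper 2≤Δ)
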